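{- (Catalan's identity.) For every integer $n \ge 1$ and every integer $r \ge 0$, \[ (Q^P_n)^2 - Q^P_{n+r}\,Q^P_{n-r} = (-1)^{n-r}\,P_r^2\; 2\,(1 + i + 6\varepsilon + 6\,i\varepsilon). \]
   Context: Dual-complex numbers are expressions $x_1 + i\,x_2 + \varepsilon\,y_1 + i\varepsilon\,y_2$ with real coefficients, forming a commutative associative real algebra with basis $\{1,i,\varepsilon,i\varepsilon\}$, where $i^2=-1$, $\varepsilon\ne 0$, $\varepsilon^2=0$, $i\varepsilon=\varepsilon i$, $(i\varepsilon)^2=0$. Pell numbers: $P_0=0$, $P_1=1$, $P_n=2P_{n-1}+P_{n-2}$, extended to negative indices by the same recurrence, i.e. $P_{ -k}=(-1)^{k+1}P_k$. The dual-complex Pell quaternion is $Q^P_k = P_k + i\,P_{k+1} + \varepsilon\,P_{k+2} + i\varepsilon\,P_{k+3}$ for every integer $k$, with products taken in the dual-complex algebra. -}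

module Defs where

open import Data.Nat using (ℕ; zero; suc)
open import Data.Integer using (ℤ; +_; -[1+_]; _+_; _*_; -_; _-_)

pellℕ : ℕ → ℤ
pellℕ zero = + 0
pellℕ (suc zero) = + 1
pellℕ (suc (suc n)) = + 2 * pellℕ (suc n) + pellℕ n

neg1^ : ℕ → ℤ
neg1^ zero = + 1
neg1^ (suc k) = - neg1^ k

neg1^ℤ : ℤ → ℤ
neg1^ℤ (+ k) = neg1^ k
neg1^ℤ -[1+ k ] = neg1^ (suc k)

-- Pell numbers on ℤ, extended by P_{-k} = (-1)^{k+1} P_k
pell : ℤ → ℤ
pell (+ k) = pellℕ k
pell -[1+ k ] = neg1^ (suc (suc k)) * pellℕ (suc k)

-- Dual-complex numbers  x1 + i x2 + ε y1 + iε y2 (integer coefficients suffice: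
-- the integer-coefficient elements form a subring of the real algebra)
record DC : Set where
  constructor dc
  field
    x1 x2 y1 y2 : ℤ

infixl 6 _+DC_ _-DC_
infixl 7 _*DC_ _·DC_

_+DC_ : DC → DC → DC
dc a b c d +DC dc a' b' c' d' = dc (a + a') (b + b') (c + c') (d + d')

_-DC_ : DC → DC → DC
dc a b c d -DC dc a' b' c' d' = dc (a - a') (b - b') (c - c') (d - d')

-- product with i² = -1, ε² = 0, iε = εi
_*DC_ : DC → DC → DC
dc a b c d *DC dc a' b' c' d' =
  dc (a * a' - b * b')
     (a * b' + b * a')
     (a * c' - b * d' + c * a' - d * b')
     (a * d' + b * c' + c * b' + d * a')

_·DC_ : ℤ → DC → DC
k ·DC dc a b c d = dc (k * a) (k * b) (k * c) (k * d)

QP : ℤ → DC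
QP k = dc (pell k) (pell (k + + 1)) (pell (k + + 2)) (pell (k + + 3))

-- Every integer sequence g with g (j + 2) = 2 g (j + 1) + g j satisfies Vajda's identity
-- g i g j − g 0 g (i + j) = e(g) P i P j, where e(g) = g₁² − 2 g₀ g₁ − g₀²: both sides satisfy
-- the recurrence in i (and, for i = 1, in j), so they agree once they agree at 0 and 1.
-- Write b = n − r and g j = P (b + j), so that Q_{b+j} has coefficients g j, …, g (j + 3).
-- Each coefficient of Q_{b+r}² − Q_{b+2r} Q_b is a fixed integer combination of y₀² − x₀z₀,
-- y₁² − x₁z₁ and (y₀ + y₁)² − (x₀ + x₁)(z₀ + z₁), with x, y, z the first two coefficients of
-- Q_b, Q_{b+r}, Q_{b+2r}. These are Vajda expressions for g, for its shift and for g plus its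
-- shift, whose characteristics are e, −e and 2e. Finally e(g) = (−1)^b is Cassini's identity;
-- it holds for negative b as well, since shifting g changes the sign of e.
module Submission where

open import Data.Integer using (ℤ; +_; -[1+_]; _+_; _*_; _-_; -_)
open import Data.Integer.Properties using (+-assoc; +-comm; *-identityˡ; *-identityʳ; neg-involutive)
open import Data.Integer.Tactic.RingSolver using (solve-∀; solve)
open import Data.List using (_∷_; [])
open import Data.Nat using (ℕ; zero; suc)
import Data.Nat as ℕ
import Data.Nat.Properties as ℕ
open import Function using (_∘_)
open import Relation.Binary.PropositionalEquality using (_≡_; refl; sym; trans; cong; cong₂; module ≡-Reasoning)

open import Defs

open ≡-Reasoning

private
  variable
    f g : ℕ → ℤ

record PellLike (g : ℕ → ℤ) : Set where
  constructor pellLike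
  field recurrence : ∀ j → g (suc (suc j)) ≡ + 2 * g (suc j) + g j

open PellLike

pellLike-unique : PellLike f → PellLike g → f 0 ≡ g 0 → f 1 ≡ g 1 → ∀ j → f j ≡ g j
pellLike-unique hf hg f₀≡g₀ f₁≡g₁ zero = f₀≡g₀
pellLike-unique hf hg f₀≡g₀ f₁≡g₁ (suc zero) = f₁≡g₁
pellLike-unique {f = f} {g = g} hf hg f₀≡g₀ f₁≡g₁ (suc (suc j)) = begin
  f (suc (suc j))         ≡⟨ recurrence hf j ⟩
  + 2 * f (suc j) + f j   ≡⟨ cong₂ (λ a b → + 2 * a + b) (pellLike-unique hf hg f₀≡g₀ f₁≡g₁ (suc j))
                                                          (pellLike-unique hf hg f₀≡g₀ f₁≡g₁ j) ⟩
  + 2 * g (suc j) + g j   ≡⟨ sym (recurrence hg j) ⟩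
  g (suc (suc j))         ∎

pellLike-*ˡ : ∀ c → PellLike f → PellLike (λ j → c * f j)
pellLike-*ˡ {f} c hf = pellLike λ j → trans (cong (c *_) (recurrence hf j)) (distrib c (f (suc j)) (f j))
  where
  distrib : ∀ c a b → c * (+ 2 * a + b) ≡ + 2 * (c * a) + c * b
  distrib = solve-∀

pellLike-*ʳ : ∀ c → PellLike f → PellLike (λ j → f j * c)
pellLike-*ʳ {f} c hf = pellLike λ j → trans (cong (_* c) (recurrence hf j)) (distrib c (f (suc j)) (f j))
  where
  distrib : ∀ c a b → (+ 2 * a + b) * c ≡ + 2 * (a * c) + b * c
  distrib = solve-∀

pellLike-+ : PellLike f → PellLike g → PellLike (λ j → f j + g j)
pellLike-+ {f} {g} hf hg = pellLike λ j →
  trans (cong₂ _+_ (recurrence hf j) (recurrence hg j)) (regroup (f (suc j)) (f j) (g (suc j)) (g j))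
  where
  regroup : ∀ a b c d → (+ 2 * a + b) + (+ 2 * c + d) ≡ + 2 * (a + c) + (b + d)
  regroup = solve-∀

pellLike-- : PellLike f → PellLike g → PellLike (λ j → f j - g j)
pellLike-- {f} {g} hf hg = pellLike λ j →
  trans (cong₂ _-_ (recurrence hf j) (recurrence hg j)) (regroup (f (suc j)) (f j) (g (suc j)) (g j))
  where
  regroup : ∀ a b c d → (+ 2 * a + b) - (+ 2 * c + d) ≡ + 2 * (a - c) + (b - d)
  regroup = solve-∀

pellLike-suc : PellLike g → PellLike (g ∘ suc)
pellLike-suc hg = pellLike (recurrence hg ∘ suc)

pellLike-+ʳ : ∀ k → PellLike g → PellLike (λ j → g (j ℕ.+ k))
pellLike-+ʳ k hg = pellLike λ j → recurrence hg (j ℕ.+ k)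

pellℕ-pellLike : PellLike pellℕ
pellℕ-pellLike = pellLike λ _ → refl

-- Vajda's characteristic g₁² − g₀g₂ of a Pell-like sequence, written without g₂.
characteristic : (ℕ → ℤ) → ℤ
characteristic g = g 1 * g 1 - + 2 * g 0 * g 1 - g 0 * g 0

characteristic-cong : (∀ j → f j ≡ g j) → characteristic f ≡ characteristic g
characteristic-cong f≗g = cong₂ (λ a b → b * b - + 2 * a * b - a * a) (f≗g 0) (f≗g 1)

characteristic-second : PellLike g → g 1 * g 1 - g 0 * g 2 ≡ characteristic g
characteristic-second {g} hg = expand (g 0) (g 1) (g 2) (recurrence hg 0)
  where
  expand : ∀ a b c → c ≡ + 2 * b + a → b * b - a * c ≡ b * b - + 2 * a * b - a * a
  expand a b _ refl = solve (a ∷ b ∷ [])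

characteristic-suc : PellLike g → characteristic (g ∘ suc) ≡ - characteristic g
characteristic-suc {g} hg = expand (g 0) (g 1) (g 2) (recurrence hg 0)
  where
  expand : ∀ a b c → c ≡ + 2 * b + a → c * c - + 2 * b * c - b * b ≡ - (b * b - + 2 * a * b - a * a)
  expand a b _ refl = solve (a ∷ b ∷ [])

characteristic-+suc : PellLike g → characteristic (λ j → g j + g (suc j)) ≡ + 2 * characteristic g
characteristic-+suc {g} hg = expand (g 0) (g 1) (g 2) (recurrence hg 0)
  where
  expand : ∀ a b c → c ≡ + 2 * b + a →
           (b + c) * (b + c) - + 2 * (a + b) * (b + c) - (a + b) * (a + b) ≡ + 2 * (b * b - + 2 * a * b - a * a)
  expand a b _ refl = solve (a ∷ b ∷ [])

vajda₁ : PellLike g → ∀ j → g 1 * g j - g 0 * g (suc j) ≡ characteristic g * pellℕ j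
vajda₁ {g} hg = pellLike-unique
  (pellLike-- (pellLike-*ˡ (g 1) hg) (pellLike-*ˡ (g 0) (pellLike-suc hg)))
  (pellLike-*ˡ (characteristic g) pellℕ-pellLike)
  (vanish (g 0) (g 1) (characteristic g))
  (trans (characteristic-second hg) (sym (*-identityʳ (characteristic g))))
  where
  vanish : ∀ a b e → b * a - a * b ≡ e * + 0
  vanish = solve-∀

vajda : PellLike g → ∀ i j → g i * g j - g 0 * g (i ℕ.+ j) ≡ characteristic g * (pellℕ i * pellℕ j)
vajda {g} hg i j = pellLike-unique
  (pellLike-- (pellLike-*ʳ (g j) hg) (pellLike-*ˡ (g 0) (pellLike-+ʳ j hg)))
  (pellLike-*ˡ (characteristic g) (pellLike-*ʳ (pellℕ j) pellℕ-pellLike))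
  (vanish (g 0) (g j) (characteristic g) (pellℕ j))
  (trans (vajda₁ hg j) (cong (characteristic g *_) (sym (*-identityˡ (pellℕ j)))))
  i
  where
  vanish : ∀ a b e p → a * b - a * b ≡ e * (+ 0 * p)
  vanish = solve-∀

cong₃ : ∀ {A B C D : Set} (h : A → B → C → D) {a a′ b b′ c c′} → a ≡ a′ → b ≡ b′ → c ≡ c′ → h a b c ≡ h a′ b′ c′
cong₃ h refl refl refl = refl

dc-cong : ∀ {a a′ b b′ c c′ d d′} → a ≡ a′ → b ≡ b′ → c ≡ c′ → d ≡ d′ → dc a b c d ≡ dc a′ b′ c′ d′
dc-cong refl refl refl refl = refl

quaternion : (ℕ → ℤ) → ℕ → DC
quaternion g j = dc (g j) (g (1 ℕ.+ j)) (g (2 ℕ.+ j)) (g (3 ℕ.+ j))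

pellQuaternion : ℤ → ℤ → DC
pellQuaternion a b = dc a b (+ 2 * b + a) (+ 2 * (+ 2 * b + a) + b)

quaternion-pellLike : PellLike g → ∀ j → quaternion g j ≡ pellQuaternion (g j) (g (suc j))
quaternion-pellLike {g} hg j = dc-cong refl refl (recurrence hg j)
  (trans (recurrence hg (suc j)) (cong (λ c → + 2 * c + g (suc j)) (recurrence hg j)))

-- A, U and B are Q(0), Q(1) and the t²-coefficient of Q(t) = (y₀ + t y₁)² − (x₀ + t x₁)(z₀ + t z₁).
catalanCombination : ℤ → ℤ → ℤ → DC
catalanCombination A B U = dc (A - B) (U - A - B) (+ 2 * A - + 10 * B) (+ 6 * U - + 2 * A - + 2 * B)

pellQuaternion-catalan : ∀ x₀ x₁ y₀ y₁ z₀ z₁ →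
  pellQuaternion y₀ y₁ *DC pellQuaternion y₀ y₁ -DC pellQuaternion z₀ z₁ *DC pellQuaternion x₀ x₁
    ≡ catalanCombination (y₀ * y₀ - x₀ * z₀) (y₁ * y₁ - x₁ * z₁) ((y₀ + y₁) * (y₀ + y₁) - (x₀ + x₁) * (z₀ + z₁))
pellQuaternion-catalan x₀ x₁ y₀ y₁ z₀ z₁ = dc-cong
  (real x₀ x₁ y₀ y₁ z₀ z₁) (imaginary x₀ x₁ y₀ y₁ z₀ z₁) (dual x₀ x₁ y₀ y₁ z₀ z₁) (imaginaryDual x₀ x₁ y₀ y₁ z₀ z₁)
  where
  real : ∀ x₀ x₁ y₀ y₁ z₀ z₁ →
    y₀ * y₀ - y₁ * y₁ - (z₀ * x₀ - z₁ * x₁)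
      ≡ (y₀ * y₀ - x₀ * z₀) - (y₁ * y₁ - x₁ * z₁)
  real = solve-∀
  imaginary : ∀ x₀ x₁ y₀ y₁ z₀ z₁ →
    y₀ * y₁ + y₁ * y₀ - (z₀ * x₁ + z₁ * x₀)
      ≡ ((y₀ + y₁) * (y₀ + y₁) - (x₀ + x₁) * (z₀ + z₁)) - (y₀ * y₀ - x₀ * z₀) - (y₁ * y₁ - x₁ * z₁)
  imaginary = solve-∀
  dual : ∀ x₀ x₁ y₀ y₁ z₀ z₁ →
    y₀ * (+ 2 * y₁ + y₀) - y₁ * (+ 2 * (+ 2 * y₁ + y₀) + y₁) + (+ 2 * y₁ + y₀) * y₀ - (+ 2 * (+ 2 * y₁ + y₀) + y₁) * y₁
      - (z₀ * (+ 2 * x₁ + x₀) - z₁ * (+ 2 * (+ 2 * x₁ + x₀) + x₁) + (+ 2 * z₁ + z₀) * x₀ - (+ 2 * (+ 2 * z₁ + z₀) + z₁) * x₁)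
      ≡ + 2 * (y₀ * y₀ - x₀ * z₀) - + 10 * (y₁ * y₁ - x₁ * z₁)
  dual = solve-∀
  imaginaryDual : ∀ x₀ x₁ y₀ y₁ z₀ z₁ →
    y₀ * (+ 2 * (+ 2 * y₁ + y₀) + y₁) + y₁ * (+ 2 * y₁ + y₀) + (+ 2 * y₁ + y₀) * y₁ + (+ 2 * (+ 2 * y₁ + y₀) + y₁) * y₀
      - (z₀ * (+ 2 * (+ 2 * x₁ + x₀) + x₁) + z₁ * (+ 2 * x₁ + x₀) + (+ 2 * z₁ + z₀) * x₁ + (+ 2 * (+ 2 * z₁ + z₀) + z₁) * x₀)
      ≡ + 6 * ((y₀ + y₁) * (y₀ + y₁) - (x₀ + x₁) * (z₀ + z₁)) - + 2 * (y₀ * y₀ - x₀ * z₀) - + 2 * (y₁ * y₁ - x₁ * z₁)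
  imaginaryDual = solve-∀

catalanCombination-alternating : ∀ e p →
  catalanCombination (e * p) (- e * p) (+ 2 * e * p) ≡ (e * p * + 2) ·DC dc (+ 1) (+ 1) (+ 6) (+ 6)
catalanCombination-alternating e p = dc-cong
  (solve (e ∷ p ∷ [])) (solve (e ∷ p ∷ [])) (solve (e ∷ p ∷ [])) (solve (e ∷ p ∷ []))

catalan : PellLike g → ∀ r →
  quaternion g r *DC quaternion g r -DC quaternion g (r ℕ.+ r) *DC quaternion g 0
    ≡ (characteristic g * (pellℕ r * pellℕ r) * + 2) ·DC dc (+ 1) (+ 1) (+ 6) (+ 6)
catalan {g} hg r = begin
  quaternion g r *DC quaternion g r -DC quaternion g (r ℕ.+ r) *DC quaternion g 0
    ≡⟨ cong₃ (λ y z x → y *DC y -DC z *DC x)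
             (quaternion-pellLike hg r) (quaternion-pellLike hg (r ℕ.+ r)) (quaternion-pellLike hg 0) ⟩
  pellQuaternion (g r) (g (suc r)) *DC pellQuaternion (g r) (g (suc r))
    -DC pellQuaternion (g (r ℕ.+ r)) (g (suc (r ℕ.+ r))) *DC pellQuaternion (g 0) (g 1)
    ≡⟨ trans (pellQuaternion-catalan (g 0) (g 1) (g r) (g (suc r)) (g (r ℕ.+ r)) (g (suc (r ℕ.+ r))))
             (cong₃ catalanCombination (vajda hg r r) shifted summed) ⟩
  catalanCombination (e * p) (- e * p) (+ 2 * e * p)
    ≡⟨ catalanCombination-alternating e p ⟩
  (e * p * + 2) ·DC dc (+ 1) (+ 1) (+ 6) (+ 6) ∎
  where
  e = characteristic g
  p = pellℕ r * pellℕ r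
  shifted : g (suc r) * g (suc r) - g 1 * g (suc (r ℕ.+ r)) ≡ - e * p
  shifted = trans (vajda (pellLike-suc hg) r r) (cong (_* p) (characteristic-suc hg))
  summed : (g r + g (suc r)) * (g r + g (suc r)) - (g 0 + g 1) * (g (r ℕ.+ r) + g (suc (r ℕ.+ r))) ≡ + 2 * e * p
  summed = trans (vajda (pellLike-+ hg (pellLike-suc hg)) r r) (cong (_* p) (characteristic-+suc hg))

pell-recurrence : ∀ k → pell (k + + 2) ≡ + 2 * pell (k + + 1) + pell k
pell-recurrence (+ n) rewrite ℕ.+-comm n 2 | ℕ.+-comm n 1 = refl
pell-recurrence -[1+ 0 ] = refl
pell-recurrence -[1+ 1 ] = refl
pell-recurrence -[1+ suc (suc n) ] = reflected (neg1^ (suc (suc n))) (pellℕ (suc (suc n))) (pellℕ (suc n))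
  where
  reflected : ∀ s a b → s * b ≡ + 2 * (- s * a) + - - s * (+ 2 * a + b)
  reflected = solve-∀

pellFrom : ℤ → ℕ → ℤ
pellFrom m j = pell (m + + j)

+-+-shift : ∀ m j k → m + + j + + k ≡ m + + (k ℕ.+ j)
+-+-shift m j k = trans (+-assoc m (+ j) (+ k)) (cong (λ x → m + x) (+-comm (+ j) (+ k)))

pellFrom-pellLike : ∀ m → PellLike (pellFrom m)
pellFrom-pellLike m = pellLike λ j → begin
  pell (m + + suc (suc j))                           ≡⟨ cong pell (sym (+-+-shift m j 2)) ⟩
  pell (m + + j + + 2)                               ≡⟨ pell-recurrence (m + + j) ⟩
  + 2 * pell (m + + j + + 1) + pell (m + + j)        ≡⟨ cong (λ k → + 2 * pell k + pell (m + + j)) (+-+-shift m j 1) ⟩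
  + 2 * pell (m + + suc j) + pell (m + + j)          ∎

pellFrom-suc : ∀ m j → pellFrom (+ 1 + m) j ≡ pellFrom m (suc j)
pellFrom-suc m j = cong pell (trans (cong (_+ + j) (+-comm (+ 1) m)) (+-assoc m (+ 1) (+ j)))

alternating-unique : (f : ℤ → ℤ) → f (+ 0) ≡ + 1 → (∀ k → f (+ 1 + k) ≡ - f k) → ∀ k → f k ≡ neg1^ℤ k
alternating-unique f f₀ step (+ zero) = f₀
alternating-unique f f₀ step (+ suc n) = trans (step (+ n)) (cong -_ (alternating-unique f f₀ step (+ n)))
alternating-unique f f₀ step -[1+ n ] = begin
  f -[1+ n ]                 ≡⟨ sym (neg-involutive _) ⟩
  - - f -[1+ n ]             ≡⟨ cong -_ (sym (step -[1+ n ])) ⟩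
  - f (+ 1 + -[1+ n ])       ≡⟨ cong -_ (previous n) ⟩
  - neg1^ n                  ∎
  where
  previous : ∀ n → f (+ 1 + -[1+ n ]) ≡ neg1^ n
  previous zero = f₀
  previous (suc n) = alternating-unique f f₀ step -[1+ n ]

cassini : ∀ m → characteristic (pellFrom m) ≡ neg1^ℤ m
cassini = alternating-unique (characteristic ∘ pellFrom) refl λ m → begin
  characteristic (pellFrom (+ 1 + m))       ≡⟨ characteristic-cong (pellFrom-suc m) ⟩
  characteristic (pellFrom m ∘ suc)         ≡⟨ characteristic-suc (pellFrom-pellLike m) ⟩
  - characteristic (pellFrom m)             ∎

QP-pellFrom : ∀ m j → QP (m + + j) ≡ quaternion (pellFrom m) j
QP-pellFrom m j = dc-cong refl (shifted 1) (shifted 2) (shifted 3)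
  where
  shifted : ∀ k → pell (m + + j + + k) ≡ pell (m + + (k ℕ.+ j))
  shifted k = cong pell (+-+-shift m j k)

theorem3p7 : (m r : ℕ) → let n = + suc m in
    QP n *DC QP n -DC QP (n + + r) *DC QP (n - + r)
      ≡ (neg1^ℤ (n - + r) * (pellℕ r * pellℕ r) * + 2) ·DC dc (+ 1) (+ 1) (+ 6) (+ 6)
theorem3p7 m r = begin
  QP n *DC QP n -DC QP (n + + r) *DC QP (n - + r)
    ≡⟨ cong₃ (λ y z x → y *DC y -DC z *DC x)
             (QP-at (n≡b+r n (+ r))) (QP-at (n+r≡b+2r n (+ r))) (QP-at (n-r≡b+0 n (+ r))) ⟩
  quaternion (pellFrom b) r *DC quaternion (pellFrom b) r
    -DC quaternion (pellFrom b) (r ℕ.+ r) *DC quaternion (pellFrom b) 0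
    ≡⟨ catalan (pellFrom-pellLike b) r ⟩
  (characteristic (pellFrom b) * (pellℕ r * pellℕ r) * + 2) ·DC dc (+ 1) (+ 1) (+ 6) (+ 6)
    ≡⟨ cong (λ e → (e * (pellℕ r * pellℕ r) * + 2) ·DC dc (+ 1) (+ 1) (+ 6) (+ 6)) (cassini b) ⟩
  (neg1^ℤ b * (pellℕ r * pellℕ r) * + 2) ·DC dc (+ 1) (+ 1) (+ 6) (+ 6) ∎
  where
  n = + suc m
  b = n - + r
  QP-at : ∀ {k j} → k ≡ b + + j → QP k ≡ quaternion (pellFrom b) j
  QP-at {j = j} refl = QP-pellFrom b j
  n≡b+r : ∀ x y → x ≡ (x - y) + y
  n≡b+r = solve-∀
  n+r≡b+2r : ∀ x y → x + y ≡ (x - y) + (y + y)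
  n+r≡b+2r = solve-∀
  n-r≡b+0 : ∀ x y → x - y ≡ (x - y) + + 0
  n-r≡b+0 = solve-∀
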